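{- If $H'$ is a monotone matching, then $(H,H')$ is Ramsey finite for each ordered graph $H$ without isolated vertices.
   Context: An ordered graph is a finite simple graph together with a linear order of its vertex set. A copy of an ordered graph $H$ in $F$ is a subgraph of $F$ (with inherited order) isomorphic to $H$ via an order-preserving bijection. $R_<(H,H')$ is the set of ordered graphs $F$ such that every red/blue coloring of the edges of $F$ contains a red copy of $H$ or a blue copy of $H'$; $F\in R_<(H,H')$ is minimal if no proper subgraph of $F$ lies in $R_<(H,H')$; $(H,H')$ is Ramsey finite if $R_<(H,H')$ has only finitely many minimal elements (up to order-preserving isomorphism). The intervally disjoint union $G\sqcup G'$ is the vertex-disjoint union of $G$ and $G'$ with all vertices of $G$ preceding all vertices of $G'$. A monotone matching is an ordered graph of the form $K_2\sqcup K_2\sqcup\cdots\sqcup K_2$ (at least one copy of $K_2$). -}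

module Defs where

open import Data.Nat using (ℕ; zero; suc; _+_)
open import Data.Fin using (Fin; splitAt; _<_)
open import Data.Bool using (Bool; true; false)
open import Data.Sum using (_⊎_; inj₁; inj₂)
open import Data.Product using (Σ; ∃; _×_; _,_)
open import Data.List using (List)
open import Data.List.Membership.Propositional using (_∈_)
open import Relation.Nullary using (¬_)
open import Relation.Binary.PropositionalEquality using (_≡_; refl)

-- An ordered graph: a finite simple graph on the vertex set Fin n,
-- linearly ordered by the natural order of Fin n.
record OGraph : Set where
  field
    n     : ℕ
    adj   : Fin n → Fin n → Bool
    adj-sym : ∀ i j → adj i j ≡ adj j i
    adj-irr : ∀ i → adj i i ≡ false
open OGraph public

StrictMono : ∀ {m n} → (Fin m → Fin n) → Set
StrictMono f = ∀ i j → i < j → f i < f j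

record Sub (G F : OGraph) : Set where
  field
    f     : Fin (n G) → Fin (n F)
    mono  : StrictMono f
    edges : ∀ i j → adj G i j ≡ true → adj F (f i) (f j) ≡ true

record Iso (G F : OGraph) : Set where
  field
    f     : Fin (n G) → Fin (n F)
    mono  : StrictMono f
    surj  : ∀ y → ∃ λ x → f x ≡ y
    edges : ∀ i j → adj G i j ≡ adj F (f i) (f j)

ProperSub : OGraph → OGraph → Set
ProperSub G F = Sub G F × ¬ Iso G F

-- Colours: true = red, false = blue.  A colouring assigns a colour to each
-- pair of vertices; only its values on edges (i,j) with i < j matter.
Colouring : OGraph → Set
Colouring F = Fin (n F) → Fin (n F) → Bool

MonoCopy : (F : OGraph) → Colouring F → Bool → OGraph → Set
MonoCopy F c col H =
  Σ (Fin (n H) → Fin (n F)) λ f → StrictMono f ×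
    (∀ i j → i < j → adj H i j ≡ true →
       (adj F (f i) (f j) ≡ true) × (c (f i) (f j) ≡ col))

Arrows : OGraph → OGraph → OGraph → Set
Arrows F H H' = ∀ (c : Colouring F) → MonoCopy F c true H ⊎ MonoCopy F c false H'

MinimalArrows : OGraph → OGraph → OGraph → Set
MinimalArrows F H H' = Arrows F H H' × (∀ G → ProperSub G F → ¬ Arrows G H H')

RamseyFinite : OGraph → OGraph → Set
RamseyFinite H H' =
  ∃ λ (L : List OGraph) → ∀ F → MinimalArrows F H H' → ∃ λ G → G ∈ L × Iso F G

NoIsolated : OGraph → Set
NoIsolated H = ∀ i → ∃ λ j → adj H i j ≡ true

module _ {A B : Set} (f : A → A → Bool) (g : B → B → Bool) where
  sumAdj : A ⊎ B → A ⊎ B → Bool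
  sumAdj (inj₁ a) (inj₁ b) = f a b
  sumAdj (inj₂ a) (inj₂ b) = g a b
  sumAdj _ _ = false

sumAdj-sym : ∀ {A B : Set} (f : A → A → Bool) (g : B → B → Bool) →
  (∀ a b → f a b ≡ f b a) → (∀ a b → g a b ≡ g b a) →
  ∀ x y → sumAdj f g x y ≡ sumAdj f g y x
sumAdj-sym f g fs gs (inj₁ a) (inj₁ b) = fs a b
sumAdj-sym f g fs gs (inj₁ a) (inj₂ b) = refl
sumAdj-sym f g fs gs (inj₂ a) (inj₁ b) = refl
sumAdj-sym f g fs gs (inj₂ a) (inj₂ b) = gs a b

sumAdj-irr : ∀ {A B : Set} (f : A → A → Bool) (g : B → B → Bool) →
  (∀ a → f a a ≡ false) → (∀ b → g b b ≡ false) →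
  ∀ x → sumAdj f g x x ≡ false
sumAdj-irr f g fi gi (inj₁ a) = fi a
sumAdj-irr f g fi gi (inj₂ b) = gi b

_⊔_ : OGraph → OGraph → OGraph
G ⊔ G' = record
  { n = n G + n G'
  ; adj = λ i j → sumAdj (adj G) (adj G') (splitAt (n G) i) (splitAt (n G) j)
  ; adj-sym = λ i j → sumAdj-sym (adj G) (adj G') (adj-sym G) (adj-sym G')
                        (splitAt (n G) i) (splitAt (n G) j)
  ; adj-irr = λ i → sumAdj-irr (adj G) (adj G') (adj-irr G) (adj-irr G')
                        (splitAt (n G) i)
  }

K2 : OGraph
K2 = record { n = 2 ; adj = a ; adj-sym = s ; adj-irr = r }
  where
  a : Fin 2 → Fin 2 → Bool
  a Fin.zero (Fin.suc Fin.zero) = true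
  a (Fin.suc Fin.zero) Fin.zero = true
  a _ _ = false
  s : ∀ i j → a i j ≡ a j i
  s Fin.zero Fin.zero = refl
  s Fin.zero (Fin.suc Fin.zero) = refl
  s (Fin.suc Fin.zero) Fin.zero = refl
  s (Fin.suc Fin.zero) (Fin.suc Fin.zero) = refl
  r : ∀ i → a i i ≡ false
  r Fin.zero = refl
  r (Fin.suc Fin.zero) = refl

-- monotone matching with (suc k) edges: K2 ⊔ K2 ⊔ ... ⊔ K2
monotoneMatching : ℕ → OGraph
monotoneMatching zero    = K2
monotoneMatching (suc k) = K2 ⊔ monotoneMatching k

IsMonotoneMatching : OGraph → Set
IsMonotoneMatching H' = ∃ λ k → Iso H' (monotoneMatching k)

module Submission where

-- Let H′ be the monotone matching with k + 1 edges and h = |H|.  It suffices to bound |F| for minimal F,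
-- since there are finitely many ordered graphs of bounded size.  We find a set L of at most bound h (k + 1)
-- vertices of F such that every colouring has a red H or a blue H′ inside L; the subgraph induced by L then
-- arrows (H, H′), so by minimality it is all of F.
--
-- L is built by induction on the number of matching edges, for suffixes H[t, h) of H starting at a cut t
-- (no edge of H crosses t) and for copies to the right of a position b.  For every cut s ≥ t, L contains an
-- earliest-ending copy of H[t, s) and, for the largest π such that no H[t, r) with r > s a cut fits below π,
-- the set given by induction for H[s, h), k edges and position π + 1.  The induction hypothesis applies:
-- colour red below π and blue across π; a blue matching then starts at or after π, and a red copy of H[t, h)
-- splits at a cut r with H[t, r) below π, so r ≤ s, while H[s, h) lies strictly above π because H has no
-- isolated vertices.  Given a colouring, let xy be the blue edge inside L with least right end y.  Either the
-- induction set beyond y extends xy to a blue H′, or it has a red H[s, h) for the last cut s such that H[t, s)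
-- fits below y, and this glues to the earliest copy of H[t, s), whose edges are red by the choice of y.

open import Data.Bool using (Bool; true; false)
open import Data.Bool.Properties using () renaming (_≟_ to _≟ᵇ_)
open import Data.Empty using (⊥; ⊥-elim)
open import Data.Fin using (Fin; zero; suc; toℕ; fromℕ<)
open import Data.Fin.Properties
  using (any?; all?; toℕ<n; toℕ-injective; toℕ-fromℕ<; _≟_; injective⇒≤) renaming (<-cmp to <-cmpFin)
open import Data.List
  using (List; []; _∷_; _++_; length; lookup; map; concatMap; cartesianProductWith; upTo; tabulate)
open import Data.List.Membership.Propositional using (_∈_; lose)
import Data.List.Membership.DecPropositional as DecMembership
open import Data.List.Membership.Propositional.Properties
  using (∈-map⁺; ∈-concatMap⁺; ∈-cartesianProductWith⁺; ∈-upTo⁺; ∈-tabulate⁺; ∈-++⁺ˡ; ∈-++⁺ʳ)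
open import Data.List.Properties using (length-++; length-tabulate; length-upTo)
open import Data.List.Relation.Unary.Any using (here; there)
import Data.List.Relation.Unary.Any as Any
open import Data.List.Relation.Unary.Any.Properties using (lookup-index)
open import Data.Nat using (ℕ; zero; suc; _+_; _*_; _≤_; _<_; z≤n; s≤s; _≤?_; _<?_)
open import Data.Nat.Properties
  using (≤-refl; ≤-reflexive; ≤-trans; ≤-pred; <-irrefl; <-asym; <-trans; <-≤-trans; <⇒≤; <⇒≱; ≮⇒≥; ≰⇒>;
         ≤∧≢⇒<; m≤n⇒m<n∨m≡n; m≤n⇒m≤1+n; +-mono-≤)
open import Data.Product using (Σ; ∃; _×_; _,_; proj₁; proj₂)
open import Data.Sum using (_⊎_; inj₁; inj₂)
open import Data.Unit using (tt)
open import Data.Vec.Functional using (Vector; head; tail) renaming (_∷_ to _∷ᵛ_)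
open import Function using (_∘_; id)
open import Relation.Binary using (tri<; tri≈; tri>)
open import Relation.Binary.PropositionalEquality
  using (_≡_; _≢_; _≗_; refl; sym; trans; cong; cong₂; subst; subst₂; module ≡-Reasoning)
open import Relation.Nullary using (¬_; Dec; yes; no; ¬?)
open import Relation.Nullary.Decidable using (decidable-stable; _×-dec_; _→-dec_)
open import Relation.Unary using (Decidable; U)

open import Defs

-- Bounded search

≤-suc-elim : ∀ {n} {Q : ℕ → Set} → (∀ m → m ≤ n → Q m) → Q (suc n) → ∀ m → m ≤ suc n → Q m
≤-suc-elim {n} below top m m≤1+n with m≤n⇒m<n∨m≡n m≤1+n
... | inj₁ m<1+n = below m (≤-pred m<1+n)
... | inj₂ refl = top

least? : (P : ℕ → Set) → Decidable P → ∀ n →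
  (∀ m → m ≤ n → ¬ P m) ⊎ ∃ λ m → P m × (∀ k → k < m → ¬ P k)
least? P P? zero with P? zero
... | yes p = inj₂ (zero , p , λ _ ())
... | no ¬p = inj₁ λ { zero _ → ¬p }
least? P P? (suc n) with least? P P? n
... | inj₂ found = inj₂ found
... | inj₁ none with P? (suc n)
...   | yes p = inj₂ (suc n , p , λ k k<1+n → none k (≤-pred k<1+n))
...   | no ¬p = inj₁ (≤-suc-elim none ¬p)

greatest? : (P : ℕ → Set) → Decidable P → ∀ n →
  (∀ m → m ≤ n → ¬ P m) ⊎ ∃ λ m → m ≤ n × P m × (∀ k → m < k → k ≤ n → ¬ P k)
greatest? P P? zero with P? zero
... | yes p = inj₂ (zero , z≤n , p , λ k 0<k k≤0 → ⊥-elim (<⇒≱ 0<k k≤0))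
... | no ¬p = inj₁ λ { zero _ → ¬p }
greatest? P P? (suc n) with P? (suc n)
... | yes p = inj₂ (suc n , ≤-refl , p , λ k n<k k≤n → ⊥-elim (<⇒≱ n<k k≤n))
... | no ¬p with greatest? P P? n
...   | inj₁ none = inj₁ (≤-suc-elim none ¬p)
...   | inj₂ (m , m≤n , pm , max) =
        inj₂ (m , m≤n⇒m≤1+n m≤n , pm , λ k m<k k≤1+n → max′ k k≤1+n m<k)
  where
  max′ : ∀ k → k ≤ suc n → m < k → ¬ P k
  max′ = ≤-suc-elim (λ k k≤n m<k → max k m<k k≤n) (λ _ → ¬p)

leastFin? : ∀ {n} (P : Fin n → Set) → Decidable P →
  (∀ x → ¬ P x) ⊎ ∃ λ y → P y × (∀ z → P z → toℕ y ≤ toℕ z)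
leastFin? {zero} P P? = inj₁ λ ()
leastFin? {suc n} P P? with P? zero
... | yes p = inj₂ (zero , p , λ _ _ → z≤n)
... | no ¬p with leastFin? (P ∘ suc) (P? ∘ suc)
...   | inj₁ none = inj₁ λ { zero → ¬p ; (suc x) → none x }
...   | inj₂ (y , py , min) =
        inj₂ (suc y , py , λ { zero pz → ⊥-elim (¬p pz) ; (suc z) pz → s≤s (min z pz) })

Searchable : Set → Set₁
Searchable A = ∀ {P : A → Set} → Decidable P → Dec (∃ P)

any-vector? : ∀ {A : Set} → Searchable A → ∀ k {P : Vector A k → Set} →
  (∀ {u v} → u ≗ v → P u → P v) → Decidable P → Dec (∃ P)
any-vector? any-A? zero {P} resp P? with P? (λ ())
... | yes p = yes (_ , p)
... | no ¬p = no λ { (u , pu) → ¬p (resp (λ ()) pu) }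
any-vector? any-A? (suc k) {P} resp P?
  with any-A? (λ a → any-vector? any-A? k (λ u≗v → resp (cons-cong a u≗v)) (λ u → P? (a ∷ᵛ u)))
  where
  cons-cong : ∀ a {u v} → u ≗ v → (a ∷ᵛ u) ≗ (a ∷ᵛ v)
  cons-cong a u≗v zero = refl
  cons-cong a u≗v (suc i) = u≗v i
... | yes (a , u , p) = yes (a ∷ᵛ u , p)
... | no ¬p = no λ { (u , pu) → ¬p (head u , tail u , resp head∷tail pu) }
  where
  head∷tail : ∀ {u : Vector _ (suc k)} → u ≗ (head u ∷ᵛ tail u)
  head∷tail zero = refl
  head∷tail (suc i) = refl

-- Order-preserving maps, copies and induced subgraphs

module _ {m n} {f : Fin m → Fin n} (f-mono : StrictMono f) where

  strictMono⇒cancel-< : ∀ a b → toℕ (f a) < toℕ (f b) → toℕ a < toℕ b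
  strictMono⇒cancel-< a b fa<fb with <-cmpFin a b
  ... | tri< a<b _ _ = a<b
  ... | tri≈ _ refl _ = ⊥-elim (<-irrefl refl fa<fb)
  ... | tri> _ _ b<a = ⊥-elim (<-asym fa<fb (f-mono b a b<a))

  strictMono⇒injective : ∀ {a b} → f a ≡ f b → a ≡ b
  strictMono⇒injective {a} {b} fa≡fb with <-cmpFin a b
  ... | tri< a<b _ _ = ⊥-elim (<-irrefl (cong toℕ fa≡fb) (f-mono a b a<b))
  ... | tri≈ _ a≡b _ = a≡b
  ... | tri> _ _ b<a = ⊥-elim (<-irrefl (cong toℕ (sym fa≡fb)) (f-mono b a b<a))

Iso-sym : ∀ {A M} → Iso A M → Iso M A
Iso-sym {A} {M} A≅M = record
  { f = inverse
  ; mono = λ y y′ y<y′ → strictMono⇒cancel-< (Iso.mono A≅M) (inverse y) (inverse y′)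
             (subst₂ (λ u v → toℕ u < toℕ v) (sym (inverse-section y)) (sym (inverse-section y′)) y<y′)
  ; surj = λ x → Iso.f A≅M x , strictMono⇒injective (Iso.mono A≅M) (inverse-section (Iso.f A≅M x))
  ; edges = λ y y′ → trans (cong₂ (adj M) (sym (inverse-section y)) (sym (inverse-section y′)))
                           (sym (Iso.edges A≅M (inverse y) (inverse y′)))
  }
  where
  inverse : Fin (n M) → Fin (n A)
  inverse y = proj₁ (Iso.surj A≅M y)
  inverse-section : ∀ y → Iso.f A≅M (inverse y) ≡ y
  inverse-section y = proj₂ (Iso.surj A≅M y)

record CopyWithin (F : OGraph) (c : Colouring F) (col : Bool) (H : OGraph) (Q : Fin (n F) → Set) : Set where
  constructor copyWithin
  field
    copy   : MonoCopy F c col H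
    inside : ∀ i → Q (proj₁ copy i)

CopyWithin-transport : ∀ {A M F c col Q} → Iso A M → CopyWithin F c col M Q → CopyWithin F c col A Q
CopyWithin-transport A≅M (copyWithin (f , f-mono , f-edges) f-within) =
  copyWithin
    (f ∘ Iso.f A≅M ,
     (λ i j i<j → f-mono _ _ (Iso.mono A≅M i j i<j)) ,
     (λ i j i<j e → f-edges _ _ (Iso.mono A≅M i j i<j) (trans (sym (Iso.edges A≅M i j)) e)))
    (f-within ∘ Iso.f A≅M)

record Enumeration (N : ℕ) (P : Fin N → Set) : Set where
  field
    size    : ℕ
    at      : Fin size → Fin N
    at-mono : StrictMono at
    at-∈    : ∀ a → P (at a)
    at-onto : ∀ x → P x → ∃ λ a → at a ≡ x

enumerate : ∀ N {P : Fin N → Set} → Decidable P → Enumeration N P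
enumerate zero P? = record { size = 0 ; at = λ () ; at-mono = λ () ; at-∈ = λ () ; at-onto = λ () }
enumerate (suc N) {P} P? with enumerate N (P? ∘ suc) | P? zero
... | E | no ¬p0 = record
  { size = size ; at = suc ∘ at ; at-mono = λ a b a<b → s≤s (at-mono a b a<b) ; at-∈ = at-∈ ; at-onto = onto }
  where
  open Enumeration E
  onto : ∀ x → P x → ∃ λ a → suc (at a) ≡ x
  onto zero p0 = ⊥-elim (¬p0 p0)
  onto (suc x) px = let (a , at-a≡x) = at-onto x px in a , cong suc at-a≡x
... | E | yes p0 = record { size = suc size ; at = at′ ; at-mono = mono′ ; at-∈ = ∈′ ; at-onto = onto′ }
  where
  open Enumeration E
  at′ : Fin (suc size) → Fin (suc N)
  at′ zero = zero
  at′ (suc a) = suc (at a)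
  mono′ : StrictMono at′
  mono′ zero (suc b) _ = s≤s z≤n
  mono′ (suc a) (suc b) (s≤s a<b) = s≤s (at-mono a b a<b)
  ∈′ : ∀ a → P (at′ a)
  ∈′ zero = p0
  ∈′ (suc a) = at-∈ a
  onto′ : ∀ x → P x → ∃ λ a → at′ a ≡ x
  onto′ zero _ = zero , refl
  onto′ (suc x) px = let (a , at-a≡x) = at-onto x px in suc a , cong suc at-a≡x

size≤length : ∀ {N} {L : List (Fin N)} (E : Enumeration N (_∈ L)) → Enumeration.size E ≤ length L
size≤length {L = L} E = injective⇒≤ λ {a} {b} same-index → strictMono⇒injective at-mono (begin
    at a                           ≡⟨ lookup-index (at-∈ a) ⟩
    lookup L (Any.index (at-∈ a))  ≡⟨ cong (lookup L) same-index ⟩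
    lookup L (Any.index (at-∈ b))  ≡⟨ lookup-index (at-∈ b) ⟨
    at b                            ∎)
  where
  open Enumeration E
  open ≡-Reasoning

Iso⇒≤ : ∀ {G F} → Iso G F → n F ≤ n G
Iso⇒≤ G≅F = injective⇒≤ (strictMono⇒injective (Iso.mono (Iso-sym G≅F)))

module Induced (F : OGraph) {P : Fin (n F) → Set} (E : Enumeration (n F) P) where
  open Enumeration E

  G : OGraph
  G = record { n = size ; adj = λ a b → adj F (at a) (at b)
             ; adj-sym = λ a b → adj-sym F (at a) (at b) ; adj-irr = adj-irr F ∘ at }

  G⊆F : Sub G F
  G⊆F = record { f = at ; mono = at-mono ; edges = λ _ _ e → e }

  preimage? : ∀ x → Dec (∃ λ a → at a ≡ x)
  preimage? x = any? λ a → at a ≟ x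

  -- Pairs not inside G get an arbitrary colour.
  extend : Colouring G → Colouring F
  extend cG x y with preimage? x | preimage? y
  ... | yes (a , _) | yes (b , _) = cG a b
  ... | _ | _ = true

  extend-at : ∀ cG {a b x y} → at a ≡ x → at b ≡ y → extend cG x y ≡ cG a b
  extend-at cG {a} {b} refl refl with preimage? (at a) | preimage? (at b)
  ... | yes (a′ , at-a′≡at-a) | yes (b′ , at-b′≡at-b)
    rewrite strictMono⇒injective at-mono at-a′≡at-a | strictMono⇒injective at-mono at-b′≡at-b = refl
  ... | no ¬p | _ = ⊥-elim (¬p (a , refl))
  ... | yes _ | no ¬p = ⊥-elim (¬p (b , refl))

  copy-restrict : ∀ {col H} cG → CopyWithin F (extend cG) col H P → MonoCopy G cG col H
  copy-restrict {col} {H} cG (copyWithin (f , f-mono , f-edges) f-within) = f′ , f′-mono , f′-edges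
    where
    f′ : Fin (n H) → Fin size
    f′ i = proj₁ (at-onto (f i) (f-within i))
    at-f′ : ∀ i → at (f′ i) ≡ f i
    at-f′ i = proj₂ (at-onto (f i) (f-within i))
    f′-mono : StrictMono f′
    f′-mono i j i<j = strictMono⇒cancel-< at-mono (f′ i) (f′ j)
      (subst₂ (λ u v → toℕ u < toℕ v) (sym (at-f′ i)) (sym (at-f′ j)) (f-mono i j i<j))
    f′-edges : ∀ i j → toℕ i < toℕ j → adj H i j ≡ true →
               adj G (f′ i) (f′ j) ≡ true × cG (f′ i) (f′ j) ≡ col
    f′-edges i j i<j e with f-edges i j i<j e
    ... | in-F , colour = subst₂ (λ u v → adj F u v ≡ true) (sym (at-f′ i)) (sym (at-f′ j)) in-F ,
                          trans (sym (extend-at cG (at-f′ i) (at-f′ j))) colour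

  induced-arrows : ∀ {H H′} →
    (∀ c → CopyWithin F c true H P ⊎ CopyWithin F c false H′ P) → Arrows G H H′
  induced-arrows {H} {H′} arrows-within cG with arrows-within (extend cG)
  ... | inj₁ red = inj₁ (copy-restrict {H = H} cG red)
  ... | inj₂ blue = inj₂ (copy-restrict {H = H′} cG blue)

minimal⇒size≤ : ∀ {F H H′} → MinimalArrows F H H′ → (L : List (Fin (n F))) →
  (∀ c → CopyWithin F c true H (_∈ L) ⊎ CopyWithin F c false H′ (_∈ L)) → n F ≤ length L
minimal⇒size≤ {F} {H} {H′} (_ , minimal) L arrows-within = decidable-stable (n F ≤? length L) λ F≰L →
  minimal G (G⊆F , λ G≅F → F≰L (≤-trans (Iso⇒≤ G≅F) (size≤length E)))
    (induced-arrows {H} {H′} arrows-within)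
  where
  open DecMembership (_≟_ {n F}) using (_∈?_)
  E : Enumeration (n F) (_∈ L)
  E = enumerate (n F) (_∈? L)
  open Induced F E

-- Blue monotone matchings

data BlueChain (X : OGraph) (c : Colouring X) (Q : Fin (n X) → Set) : ℕ → ℕ → Set where
  []   : ∀ {b} → BlueChain X c Q 0 b
  edge : ∀ {k b} x y → b ≤ toℕ x → toℕ x < toℕ y → Q x → Q y → adj X x y ≡ true → c x y ≡ false →
         BlueChain X c Q k (suc (toℕ y)) → BlueChain X c Q (suc k) b

BlueChain-map : ∀ {X c c′ Q Q′ k b b′} → b ≤ b′ →
  (∀ x y → b′ ≤ toℕ x → toℕ x < toℕ y → c x y ≡ false → c′ x y ≡ false) →
  (∀ {x} → Q x → Q′ x) → BlueChain X c Q k b′ → BlueChain X c′ Q′ k b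
BlueChain-map b≤b′ recolour Q⊆Q′ [] = []
BlueChain-map b≤b′ recolour Q⊆Q′ (edge x y b′≤x x<y qx qy e blue rest) =
  edge x y (≤-trans b≤b′ b′≤x) x<y (Q⊆Q′ qx) (Q⊆Q′ qy) e (recolour x y b′≤x x<y blue)
    (BlueChain-map ≤-refl (λ x′ y′ y<x′ → recolour x′ y′ (≤-trans b′≤x (<⇒≤ (<-trans x<y y<x′))))
      Q⊆Q′ rest)

module _ {X : OGraph} {c : Colouring X} {Q : Fin (n X) → Set} where

  matching⇒blueChain : ∀ k → CopyWithin X c false (monotoneMatching k) Q → BlueChain X c Q (suc k) 0
  matching⇒blueChain k (copyWithin (f , f-mono , f-edges) f-within) =
    chain k f f-mono f-edges f-within (λ _ → z≤n)
    where
    chain : ∀ k {b} (f : Fin (n (monotoneMatching k)) → Fin (n X)) → StrictMono f →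
      (∀ i j → toℕ i < toℕ j → adj (monotoneMatching k) i j ≡ true →
         adj X (f i) (f j) ≡ true × c (f i) (f j) ≡ false) →
      (∀ i → Q (f i)) → (∀ i → b ≤ toℕ (f i)) → BlueChain X c Q (suc k) b
    chain zero f f-mono f-edges f-within f-above =
      edge (f zero) (f (suc zero)) (f-above zero) (f-mono zero (suc zero) (s≤s z≤n))
        (f-within zero) (f-within (suc zero))
        (proj₁ (f-edges zero (suc zero) (s≤s z≤n) refl)) (proj₂ (f-edges zero (suc zero) (s≤s z≤n) refl)) []
    chain (suc k) f f-mono f-edges f-within f-above =
      edge (f zero) (f (suc zero)) (f-above zero) (f-mono zero (suc zero) (s≤s z≤n))
        (f-within zero) (f-within (suc zero))
        (proj₁ (f-edges zero (suc zero) (s≤s z≤n) refl)) (proj₂ (f-edges zero (suc zero) (s≤s z≤n) refl))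
        (chain k (λ i → f (suc (suc i)))
          (λ i j i<j → f-mono (suc (suc i)) (suc (suc j)) (s≤s (s≤s i<j)))
          (λ i j i<j → f-edges (suc (suc i)) (suc (suc j)) (s≤s (s≤s i<j)))
          (λ i → f-within (suc (suc i)))
          (λ i → f-mono (suc zero) (suc (suc i)) (s≤s (s≤s z≤n))))

  blueChain⇒matching : ∀ k {b} → BlueChain X c Q (suc k) b → CopyWithin X c false (monotoneMatching k) Q
  blueChain⇒matching k chain = proj₁ (matching k chain)
    where
    matching : ∀ k {b} → BlueChain X c Q (suc k) b →
      Σ (CopyWithin X c false (monotoneMatching k) Q) λ copy →
        ∀ i → b ≤ toℕ (proj₁ (CopyWithin.copy copy) i)
    matching zero {b} (edge x y b≤x x<y qx qy e blue []) = (copyWithin (f , f-mono , f-edges) f-within) , f-above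
      where
      f : Fin 2 → Fin (n X)
      f zero = x
      f (suc zero) = y
      f-mono : StrictMono f
      f-mono zero (suc zero) _ = x<y
      f-mono (suc zero) (suc zero) (s≤s ())
      f-edges : ∀ i j → toℕ i < toℕ j → adj K2 i j ≡ true →
                adj X (f i) (f j) ≡ true × c (f i) (f j) ≡ false
      f-edges zero (suc zero) _ _ = e , blue
      f-edges (suc zero) (suc zero) (s≤s ()) _
      f-within : ∀ i → Q (f i)
      f-within zero = qx
      f-within (suc zero) = qy
      f-above : ∀ i → b ≤ toℕ (f i)
      f-above zero = b≤x
      f-above (suc zero) = ≤-trans b≤x (<⇒≤ x<y)
    matching (suc k) {b} (edge x y b≤x x<y qx qy e blue rest) with matching k rest
    ... | (copyWithin (g , g-mono , g-edges) g-within) , g-above =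
          (copyWithin (f , f-mono , f-edges) f-within) , f-above
      where
      f : Fin (2 + n (monotoneMatching k)) → Fin (n X)
      f zero = x
      f (suc zero) = y
      f (suc (suc i)) = g i
      f-mono : StrictMono f
      f-mono zero (suc zero) _ = x<y
      f-mono zero (suc (suc j)) _ = <-trans x<y (g-above j)
      f-mono (suc zero) (suc (suc j)) _ = g-above j
      f-mono (suc (suc i)) (suc (suc j)) (s≤s (s≤s i<j)) = g-mono i j i<j
      f-mono (suc zero) (suc zero) (s≤s ())
      f-mono (suc (suc i)) (suc zero) (s≤s ())
      f-edges : ∀ i j → toℕ i < toℕ j → adj (monotoneMatching (suc k)) i j ≡ true →
                adj X (f i) (f j) ≡ true × c (f i) (f j) ≡ false
      f-edges zero (suc zero) _ _ = e , blue
      f-edges (suc (suc i)) (suc (suc j)) (s≤s (s≤s i<j)) e′ = g-edges i j i<j e′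
      f-edges (suc zero) (suc zero) (s≤s ()) _
      f-edges (suc (suc i)) (suc zero) (s≤s ()) _
      f-within : ∀ i → Q (f i)
      f-within zero = qx
      f-within (suc zero) = qy
      f-within (suc (suc i)) = g-within i
      f-above : ∀ i → b ≤ toℕ (f i)
      f-above zero = b≤x
      f-above (suc zero) = ≤-trans b≤x (<⇒≤ x<y)
      f-above (suc (suc i)) = ≤-trans b≤x (<⇒≤ (<-trans x<y (g-above i)))

-- Ordered graphs of bounded size

functions : ∀ {A : Set} k → List A → List (Vector A k)
functions zero xs = (λ ()) ∷ []
functions (suc k) xs = cartesianProductWith _∷ᵛ_ xs (functions k xs)

functions-complete : ∀ {A B : Set} (R : A → B → Set) k {xs : List A} (u : Vector B k) →
  (∀ i → ∃ λ a → a ∈ xs × R a (u i)) → ∃ λ v → v ∈ functions k xs × (∀ i → R (v i) (u i))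
functions-complete R zero u covered = (λ ()) , here refl , λ ()
functions-complete R (suc k) u covered
  with covered zero | functions-complete R k (tail u) (covered ∘ suc)
... | a , a∈xs , Ra | v , v∈fs , Rv =
  a ∷ᵛ v , ∈-cartesianProductWith⁺ _∷ᵛ_ a∈xs v∈fs , λ { zero → Ra ; (suc i) → Rv i }

matrices : ∀ k → List (Fin k → Fin k → Bool)
matrices k = functions k (functions k (true ∷ false ∷ []))

matrices-complete : ∀ k (u : Fin k → Fin k → Bool) →
  ∃ λ w → w ∈ matrices k × (∀ i j → w i j ≡ u i j)
matrices-complete k u = functions-complete (λ row row′ → row ≗ row′) k u
  λ i → functions-complete _≡_ k (u i) λ j → bool-listed (u i j)
  where
  bool-listed : ∀ v → ∃ λ a → a ∈ true ∷ false ∷ [] × a ≡ v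
  bool-listed true = true , here refl , refl
  bool-listed false = false , there (here refl) , refl

module _ {k : ℕ} (w : Fin k → Fin k → Bool) where

  upper : Fin k → Fin k → Bool
  upper i j with <-cmpFin i j
  ... | tri< _ _ _ = w i j
  ... | tri≈ _ _ _ = false
  ... | tri> _ _ _ = w j i

  upper-sym : ∀ i j → upper i j ≡ upper j i
  upper-sym i j with <-cmpFin i j | <-cmpFin j i
  ... | tri< _ _ _ | tri> _ _ _ = refl
  ... | tri≈ _ _ _ | tri≈ _ _ _ = refl
  ... | tri> _ _ _ | tri< _ _ _ = refl
  ... | tri< i<j _ _ | tri< j<i _ _ = ⊥-elim (<-asym i<j j<i)
  ... | tri< _ i≢j _ | tri≈ _ j≡i _ = ⊥-elim (i≢j (sym j≡i))
  ... | tri≈ _ i≡j _ | tri< _ j≢i _ = ⊥-elim (j≢i (sym i≡j))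
  ... | tri≈ _ i≡j _ | tri> _ j≢i _ = ⊥-elim (j≢i (sym i≡j))
  ... | tri> _ i≢j _ | tri≈ _ j≡i _ = ⊥-elim (i≢j (sym j≡i))
  ... | tri> _ _ j<i | tri> _ _ i<j = ⊥-elim (<-asym i<j j<i)

  upper-irr : ∀ i → upper i i ≡ false
  upper-irr i with <-cmpFin i i
  ... | tri< _ i≢i _ = ⊥-elim (i≢i refl)
  ... | tri≈ _ _ _ = refl
  ... | tri> _ i≢i _ = ⊥-elim (i≢i refl)

  fromUpper : OGraph
  fromUpper = record { n = k ; adj = upper ; adj-sym = upper-sym ; adj-irr = upper-irr }

fromUpper-iso : ∀ F (w : Fin (n F) → Fin (n F) → Bool) → (∀ i j → w i j ≡ adj F i j) → Iso F (fromUpper w)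
fromUpper-iso F w w≡adj = record
  { f = λ i → i ; mono = λ _ _ i<j → i<j ; surj = λ y → y , refl ; edges = edges }
  where
  edges : ∀ i j → adj F i j ≡ upper w i j
  edges i j with <-cmpFin i j
  ... | tri< _ _ _ = sym (w≡adj i j)
  ... | tri≈ _ refl _ = adj-irr F i
  ... | tri> _ _ _ = trans (adj-sym F i j) (sym (w≡adj j i))

graphsUpTo : ℕ → List OGraph
graphsUpTo B = concatMap (λ k → map fromUpper (matrices k)) (upTo (suc B))

graphsUpTo-complete : ∀ B F → n F ≤ B → ∃ λ G → G ∈ graphsUpTo B × Iso F G
graphsUpTo-complete B F F≤B with matrices-complete (n F) (adj F)
... | w , w∈matrices , w≡adj =
  fromUpper w ,
  ∈-concatMap⁺ (λ k → map fromUpper (matrices k))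
    (lose (∈-upTo⁺ (s≤s F≤B)) (∈-map⁺ fromUpper w∈matrices)) ,
  fromUpper-iso F w w≡adj

-- The small arrowing set

true≢false : true ≢ false
true≢false ()

bound : ℕ → ℕ → ℕ
bound h zero = 0
bound h (suc k) = suc h * (h + bound h k)

length-concatMap≤ : ∀ {A B : Set} (f : A → List B) {m} → (∀ x → length (f x) ≤ m) →
  ∀ xs → length (concatMap f xs) ≤ length xs * m
length-concatMap≤ f bounded [] = z≤n
length-concatMap≤ f bounded (x ∷ xs) =
  ≤-trans (≤-reflexive (length-++ (f x))) (+-mono-≤ (bounded x) (length-concatMap≤ f bounded xs))

module Core (F H : OGraph) (H-noIsolated : NoIsolated H) where

  private
    N h : ℕ
    N = n F
    h = n H

  record RedSuffixCopy (c : Colouring F) (t : ℕ) (Q : Fin N → Set) : Set where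
    field
      emb    : Fin h → Fin N
      mono   : ∀ i j → t ≤ toℕ i → toℕ i < toℕ j → toℕ (emb i) < toℕ (emb j)
      red    : ∀ i j → t ≤ toℕ i → toℕ i < toℕ j → adj H i j ≡ true →
               adj F (emb i) (emb j) ≡ true × c (emb i) (emb j) ≡ true
      within : ∀ i → t ≤ toℕ i → Q (emb i)

  RedSuffixCopy-within : ∀ {c t Q Q′} → (∀ {x} → Q x → Q′ x) → RedSuffixCopy c t Q → RedSuffixCopy c t Q′
  RedSuffixCopy-within Q⊆Q′ copy =
    record { emb = emb ; mono = mono ; red = red ; within = λ i t≤i → Q⊆Q′ (within i t≤i) }
    where open RedSuffixCopy copy

  RedSuffixCopy-empty : ∀ {c Q} → (Fin h → Fin N) → RedSuffixCopy c h Q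
  RedSuffixCopy-empty f = record
    { emb = f ; mono = λ i _ h≤i → ⊥-elim (beyond i h≤i) ; red = λ i _ h≤i → ⊥-elim (beyond i h≤i)
    ; within = λ i h≤i → ⊥-elim (beyond i h≤i) }
    where
    beyond : ∀ i → ¬ h ≤ toℕ i
    beyond i = <⇒≱ (toℕ<n i)

  SuffixArrows : ℕ → ℕ → ℕ → (Fin N → Set) → Set
  SuffixArrows t k b Q = ∀ c → RedSuffixCopy c t (λ x → Q x × b ≤ toℕ x) ⊎ BlueChain F c Q k b

  SuffixArrows-weaken : ∀ {t k b b′ Q Q′} → b ≤ b′ → (∀ {x} → Q x → Q′ x) →
    SuffixArrows t k b′ Q → SuffixArrows t k b Q′
  SuffixArrows-weaken b≤b′ Q⊆Q′ arrows c with arrows c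
  ... | inj₁ copy = inj₁ (RedSuffixCopy-within (λ (q , b′≤x) → Q⊆Q′ q , ≤-trans b≤b′ b′≤x) copy)
  ... | inj₂ chain = inj₂ (BlueChain-map b≤b′ (λ _ _ _ _ blue → blue) Q⊆Q′ chain)

  IsCut : ℕ → Set
  IsCut r = ∀ i j → toℕ i < r → r ≤ toℕ j → adj H i j ≡ false

  IsCut? : ∀ r → Dec (IsCut r)
  IsCut? r = all? λ i → all? λ j → (toℕ i <? r) →-dec ((r ≤? toℕ j) →-dec (adj H i j ≟ᵇ false))

  IsCut-zero : IsCut 0
  IsCut-zero i j ()

  IsCut-end : IsCut h
  IsCut-end i j _ h≤j = ⊥-elim (<⇒≱ (toℕ<n j) h≤j)

  SegmentCopy : (t r b p : ℕ) → (Fin h → Fin N) → Set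
  SegmentCopy t r b p f =
    (∀ i j → t ≤ toℕ i → toℕ i < toℕ j → toℕ j < r → toℕ (f i) < toℕ (f j)) ×
    (∀ i j → t ≤ toℕ i → toℕ i < toℕ j → toℕ j < r → adj H i j ≡ true → adj F (f i) (f j) ≡ true) ×
    (∀ i → t ≤ toℕ i → toℕ i < r → b ≤ toℕ (f i) × toℕ (f i) < p)

  SegmentCopy? : ∀ t r b p → Decidable (SegmentCopy t r b p)
  SegmentCopy? t r b p f =
    (all? λ i → all? λ j → (t ≤? toℕ i) →-dec ((toℕ i <? toℕ j) →-dec ((toℕ j <? r) →-dec
      (toℕ (f i) <? toℕ (f j)))))
    ×-dec
    (all? λ i → all? λ j → (t ≤? toℕ i) →-dec ((toℕ i <? toℕ j) →-dec ((toℕ j <? r) →-dec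
      ((adj H i j ≟ᵇ true) →-dec (adj F (f i) (f j) ≟ᵇ true)))))
    ×-dec
    (all? λ i → (t ≤? toℕ i) →-dec ((toℕ i <? r) →-dec ((b ≤? toℕ (f i)) ×-dec (toℕ (f i) <? p))))

  SegmentCopy-resp : ∀ {t r b p f g} → f ≗ g → SegmentCopy t r b p f → SegmentCopy t r b p g
  SegmentCopy-resp {b = b} {p = p} f≗g (f-mono , f-edges , f-window) =
    (λ i j t≤i i<j j<r → subst₂ (λ u v → toℕ u < toℕ v) (f≗g i) (f≗g j) (f-mono i j t≤i i<j j<r)) ,
    (λ i j t≤i i<j j<r e →
       subst₂ (λ u v → adj F u v ≡ true) (f≗g i) (f≗g j) (f-edges i j t≤i i<j j<r e)) ,
    (λ i t≤i i<r → subst (λ u → b ≤ toℕ u × toℕ u < p) (f≗g i) (f-window i t≤i i<r))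

  SegmentCopy-widen : ∀ {t r b p p′ f} → p ≤ p′ → SegmentCopy t r b p f → SegmentCopy t r b p′ f
  SegmentCopy-widen p≤p′ (f-mono , f-edges , f-window) =
    f-mono , f-edges , λ i t≤i i<r → let (b≤fi , fi<p) = f-window i t≤i i<r in b≤fi , <-≤-trans fi<p p≤p′

  SegmentCopy-empty : ∀ {t b p} (f : Fin h → Fin N) → SegmentCopy t t b p f
  SegmentCopy-empty f =
    (λ i j t≤i i<j j<t → ⊥-elim (<⇒≱ (<-trans i<j j<t) t≤i)) ,
    (λ i j t≤i i<j j<t → ⊥-elim (<⇒≱ (<-trans i<j j<t) t≤i)) ,
    (λ i t≤i i<t → ⊥-elim (<⇒≱ i<t t≤i))

  HasSegmentCopy : (t r b p : ℕ) → Set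
  HasSegmentCopy t r b p = ∃ (SegmentCopy t r b p)

  HasSegmentCopy? : ∀ t r b p → Dec (HasSegmentCopy t r b p)
  HasSegmentCopy? t r b p = any-vector? any? h SegmentCopy-resp (SegmentCopy? t r b p)

  HasSegmentCopy-unbounded : ∀ {t r b p} → HasSegmentCopy t r b p → HasSegmentCopy t r b N
  HasSegmentCopy-unbounded (f , f-mono , f-edges , f-window) =
    f , f-mono , f-edges , λ i t≤i i<r → proj₁ (f-window i t≤i i<r) , toℕ<n (f i)

  RedSuffixCopy⇒SegmentCopy : ∀ {c t r b p} {Q : Fin N → Set}
    (copy : RedSuffixCopy c t (λ x → Q x × b ≤ toℕ x)) →
    (∀ i → t ≤ toℕ i → toℕ i < r → toℕ (RedSuffixCopy.emb copy i) < p) →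
    SegmentCopy t r b p (RedSuffixCopy.emb copy)
  RedSuffixCopy⇒SegmentCopy copy below-p =
    (λ i j t≤i i<j _ → mono i j t≤i i<j) ,
    (λ i j t≤i i<j _ e → proj₁ (red i j t≤i i<j e)) ,
    (λ i t≤i i<r → proj₂ (within i t≤i) , below-p i t≤i i<r)
    where open RedSuffixCopy copy

  LaterCutFits : (t s b p : ℕ) → Set
  LaterCutFits t s b p = ∃ λ (r : Fin (suc h)) → s < toℕ r × IsCut (toℕ r) × HasSegmentCopy t (toℕ r) b p

  LaterCutFits? : ∀ t s b p → Dec (LaterCutFits t s b p)
  LaterCutFits? t s b p = any? λ r → (s <? toℕ r) ×-dec IsCut? (toℕ r) ×-dec HasSegmentCopy? t (toℕ r) b p

  pivotColouring : ℕ → Colouring F → Colouring F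
  pivotColouring π c x y with toℕ y <? π | π <? toℕ x
  ... | yes _ | _ = true
  ... | no _ | yes _ = c x y
  ... | no _ | no _ = false

  pivotColouring-below : ∀ π c x y → toℕ y < π → pivotColouring π c x y ≡ true
  pivotColouring-below π c x y y<π with toℕ y <? π
  ... | yes _ = refl
  ... | no y≮π = ⊥-elim (y≮π y<π)

  pivotColouring-spanning : ∀ π c x y → toℕ x ≤ π → π ≤ toℕ y → pivotColouring π c x y ≡ false
  pivotColouring-spanning π c x y x≤π π≤y with toℕ y <? π | π <? toℕ x
  ... | yes y<π | _ = ⊥-elim (<⇒≱ y<π π≤y)
  ... | no _ | yes π<x = ⊥-elim (<⇒≱ π<x x≤π)
  ... | no _ | no _ = refl

  pivotColouring-above : ∀ π c x y → π < toℕ x → π < toℕ y → pivotColouring π c x y ≡ c x y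
  pivotColouring-above π c x y π<x π<y with toℕ y <? π | π <? toℕ x
  ... | yes y<π | _ = ⊥-elim (<-asym y<π π<y)
  ... | no _ | yes _ = refl
  ... | no _ | no π≮x = ⊥-elim (π≮x π<x)

  record Threshold (t π : ℕ) (f : Fin h → Fin N) : Set where
    field
      r     : ℕ
      t≤r   : t ≤ r
      r≤h   : r ≤ h
      below : ∀ i → t ≤ toℕ i → toℕ i < r → toℕ (f i) < π
      above : ∀ j → t ≤ toℕ j → r ≤ toℕ j → π ≤ toℕ (f j)

  threshold : ∀ {t} π (f : Fin h → Fin N) → (∀ i j → t ≤ toℕ i → toℕ i < toℕ j → toℕ (f i) < toℕ (f j)) →
    t ≤ h → Threshold t π f
  threshold {t} π f f-mono t≤h
    with leastFin? (λ i → t ≤ toℕ i × π ≤ toℕ (f i)) (λ i → (t ≤? toℕ i) ×-dec (π ≤? toℕ (f i)))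
  ... | inj₁ none = record
    { r = h ; t≤r = t≤h ; r≤h = ≤-refl
    ; below = λ i t≤i _ → ≰⇒> λ π≤fi → none i (t≤i , π≤fi)
    ; above = λ j _ h≤j → ⊥-elim (<⇒≱ (toℕ<n j) h≤j) }
  ... | inj₂ (i₀ , (t≤i₀ , π≤fi₀) , i₀-least) = record
    { r = toℕ i₀ ; t≤r = t≤i₀ ; r≤h = <⇒≤ (toℕ<n i₀)
    ; below = λ i t≤i i<i₀ → ≰⇒> λ π≤fi → <⇒≱ i<i₀ (i₀-least i (t≤i , π≤fi))
    ; above = above }
    where
    above : ∀ j → t ≤ toℕ j → toℕ i₀ ≤ toℕ j → π ≤ toℕ (f j)
    above j t≤j i₀≤j with m≤n⇒m<n∨m≡n i₀≤j
    ... | inj₁ i₀<j = ≤-trans π≤fi₀ (<⇒≤ (f-mono i₀ j t≤i₀ i₀<j))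
    ... | inj₂ i₀≡j = subst (λ z → π ≤ toℕ (f z)) (toℕ-injective i₀≡j) π≤fi₀

  neighbour-past-cut : ∀ {t} → IsCut t → ∀ i → t ≤ toℕ i → ∃ λ j → t ≤ toℕ j ×
    ((toℕ i < toℕ j × adj H i j ≡ true) ⊎ (toℕ j < toℕ i × adj H j i ≡ true))
  neighbour-past-cut {t} t-cut i t≤i with H-noIsolated i
  ... | j , e with <-cmpFin j i | t ≤? toℕ j
  ...   | tri< j<i _ _ | yes t≤j = j , t≤j , inj₂ (j<i , trans (adj-sym H j i) e)
  ...   | tri< j<i _ _ | no t≰j =
          ⊥-elim (true≢false (trans (sym e) (trans (adj-sym H i j) (t-cut j i (≰⇒> t≰j) t≤i))))
  ...   | tri≈ _ refl _ | _ = ⊥-elim (true≢false (trans (sym e) (adj-irr H i)))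
  ...   | tri> _ _ i<j | _ = j , ≤-trans t≤i (<⇒≤ i<j) , inj₁ (i<j , e)

  LaterCutFits-intro : ∀ {t s b p r} → s < r → r ≤ h → IsCut r → HasSegmentCopy t r b p → LaterCutFits t s b p
  LaterCutFits-intro {t} {s} {b} {p} s<r r≤h r-cut r-copy =
    fromℕ< (s≤s r≤h) ,
    subst (λ z → s < z × IsCut z × HasSegmentCopy t z b p) (sym (toℕ-fromℕ< (s≤s r≤h)))
      (s<r , r-cut , r-copy)

  chain-past-pivot : ∀ {k b π c} → BlueChain F (pivotColouring π c) U (suc k) b → BlueChain F c U k (suc π)
  chain-past-pivot {π = π} {c} (edge x y _ _ _ _ _ blue rest) =
    BlueChain-map (s≤s π≤y) recolour id rest
    where
    π≤y : π ≤ toℕ y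
    π≤y = ≮⇒≥ λ y<π → true≢false (trans (sym (pivotColouring-below π c x y y<π)) blue)
    recolour : ∀ x′ y′ → suc (toℕ y) ≤ toℕ x′ → toℕ x′ < toℕ y′ →
               pivotColouring π c x′ y′ ≡ false → c x′ y′ ≡ false
    recolour x′ y′ y<x′ x′<y′ = trans (sym (pivotColouring-above π c x′ y′ π<x′ (<-trans π<x′ x′<y′)))
      where
      π<x′ : π < toℕ x′
      π<x′ = ≤-trans (s≤s π≤y) y<x′

  copy-past-pivot : ∀ {t s b π c} → IsCut t → t ≤ s → s ≤ h → ¬ LaterCutFits t s b π →
    RedSuffixCopy (pivotColouring π c) t (λ x → U x × b ≤ toℕ x) →
    RedSuffixCopy c s (λ x → U x × suc π ≤ toℕ x)
  copy-past-pivot {t} {s} {b} {π} {c} t-cut t≤s s≤h no-later copy = record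
    { emb = emb
    ; mono = λ i j s≤i → mono i j (≤-trans t≤s s≤i)
    ; red = red-above
    ; within = λ i s≤i → tt , above-pivot i s≤i }
    where
    open RedSuffixCopy copy
    open Threshold (threshold π emb mono (≤-trans t≤s s≤h))

    no-spanning-edge : ∀ i j → t ≤ toℕ i → toℕ i < toℕ j → adj H i j ≡ true →
      toℕ (emb i) ≤ π → π ≤ toℕ (emb j) → ⊥
    no-spanning-edge i j t≤i i<j e i≤π π≤j = true≢false (trans (sym (proj₂ (red i j t≤i i<j e)))
      (pivotColouring-spanning π c (emb i) (emb j) i≤π π≤j))

    r-cut : IsCut r
    r-cut i j i<r r≤j with t ≤? toℕ i
    ... | no t≰i = t-cut i j (≰⇒> t≰i) (≤-trans t≤r r≤j)
    ... | yes t≤i with adj H i j in e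
    ...   | false = refl
    ...   | true = ⊥-elim (no-spanning-edge i j t≤i (<-≤-trans i<r r≤j) e
                     (<⇒≤ (below i t≤i i<r)) (above j (≤-trans t≤r r≤j) r≤j))

    r≤s : r ≤ s
    r≤s = ≮⇒≥ λ s<r →
      no-later (LaterCutFits-intro s<r r≤h r-cut (emb , RedSuffixCopy⇒SegmentCopy copy below))

    above-pivot : ∀ i → s ≤ toℕ i → π < toℕ (emb i)
    above-pivot i s≤i = ≤∧≢⇒< π≤i π≢i
      where
      t≤i = ≤-trans t≤s s≤i
      π≤i = above i t≤i (≤-trans r≤s s≤i)
      π≢i : π ≢ toℕ (emb i)
      π≢i π≡i with neighbour-past-cut t-cut i t≤i
      ... | j , t≤j , inj₁ (i<j , e) =
            no-spanning-edge i j t≤i i<j e (≤-reflexive (sym π≡i)) (≤-trans π≤i (<⇒≤ (mono i j t≤i i<j)))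
      ... | j , t≤j , inj₂ (j<i , e) =
            no-spanning-edge j i t≤j j<i e (≤-trans (<⇒≤ (mono j i t≤j j<i)) (≤-reflexive (sym π≡i))) π≤i

    red-above : ∀ i j → s ≤ toℕ i → toℕ i < toℕ j → adj H i j ≡ true →
                adj F (emb i) (emb j) ≡ true × c (emb i) (emb j) ≡ true
    red-above i j s≤i i<j e with red i j (≤-trans t≤s s≤i) i<j e
    ... | in-F , colour = in-F , trans (sym (pivotColouring-above π c (emb i) (emb j)
                            (above-pivot i s≤i) (above-pivot j (≤-trans s≤i (<⇒≤ i<j))))) colour

  arrows-past-pivot : ∀ {t s k b π} → IsCut t → t ≤ s → s ≤ h → ¬ LaterCutFits t s b π →
    SuffixArrows t (suc k) b U → SuffixArrows s k (suc π) U
  arrows-past-pivot {π = π} t-cut t≤s s≤h no-later arrows c with arrows (pivotColouring π c)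
  ... | inj₁ copy = inj₁ (copy-past-pivot t-cut t≤s s≤h no-later copy)
  ... | inj₂ chain = inj₂ (chain-past-pivot chain)

  glue : ∀ {c t s b p} {Q : Fin N → Set} {g : Fin h → Fin N} → IsCut s → SegmentCopy t s b p g →
    (∀ i j → t ≤ toℕ i → toℕ i < toℕ j → toℕ j < s → adj H i j ≡ true → c (g i) (g j) ≡ true) →
    (∀ i → t ≤ toℕ i → toℕ i < s → Q (g i)) →
    RedSuffixCopy c s (λ x → Q x × p < toℕ x) → RedSuffixCopy c t Q
  glue {c} {t} {s} {b} {p} {Q} {g} s-cut (g-mono , g-edges , g-window) g-red g-within suffix = record
    { emb = glued ; mono = glued-mono ; red = glued-red ; within = glued-within }
    where
    open RedSuffixCopy suffix renaming (emb to f; mono to f-mono; red to f-red; within to f-within)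

    glued : Fin h → Fin N
    glued i with toℕ i <? s
    ... | yes _ = g i
    ... | no _ = f i

    side : ∀ i → (toℕ i < s × glued i ≡ g i) ⊎ (s ≤ toℕ i × glued i ≡ f i)
    side i with toℕ i <? s
    ... | yes i<s = inj₁ (i<s , refl)
    ... | no i≮s = inj₂ (≮⇒≥ i≮s , refl)

    glued-mono : ∀ i j → t ≤ toℕ i → toℕ i < toℕ j → toℕ (glued i) < toℕ (glued j)
    glued-mono i j t≤i i<j with side i | side j
    ... | inj₁ (i<s , gi) | inj₁ (j<s , gj) rewrite gi | gj = g-mono i j t≤i i<j j<s
    ... | inj₁ (i<s , gi) | inj₂ (s≤j , fj) rewrite gi | fj =
          <-trans (proj₂ (g-window i t≤i i<s)) (proj₂ (f-within j s≤j))
    ... | inj₂ (s≤i , _) | inj₁ (j<s , _) = ⊥-elim (<⇒≱ (<-trans i<j j<s) s≤i)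
    ... | inj₂ (s≤i , fi) | inj₂ (s≤j , fj) rewrite fi | fj = f-mono i j s≤i i<j

    glued-red : ∀ i j → t ≤ toℕ i → toℕ i < toℕ j → adj H i j ≡ true →
                adj F (glued i) (glued j) ≡ true × c (glued i) (glued j) ≡ true
    glued-red i j t≤i i<j e with side i | side j
    ... | inj₁ (i<s , gi) | inj₁ (j<s , gj) rewrite gi | gj =
          g-edges i j t≤i i<j j<s e , g-red i j t≤i i<j j<s e
    ... | inj₁ (i<s , _) | inj₂ (s≤j , _) = ⊥-elim (true≢false (trans (sym e) (s-cut i j i<s s≤j)))
    ... | inj₂ (s≤i , _) | inj₁ (j<s , _) = ⊥-elim (<⇒≱ (<-trans i<j j<s) s≤i)
    ... | inj₂ (s≤i , fi) | inj₂ (s≤j , fj) rewrite fi | fj = f-red i j s≤i i<j e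

    glued-within : ∀ i → t ≤ toℕ i → Q (glued i)
    glued-within i t≤i with side i
    ... | inj₁ (i<s , gi) rewrite gi = g-within i t≤i i<s
    ... | inj₂ (s≤i , fi) rewrite fi = proj₁ (f-within i s≤i)

  HasSmallArrowingSet : ℕ → Set
  HasSmallArrowingSet k = ∀ {t b} → IsCut t → t ≤ h → SuffixArrows t k b U →
    Σ (List (Fin N)) λ L → length L ≤ bound h k × SuffixArrows t k b (_∈ L)

  module Step (k : ℕ) (induction : HasSmallArrowingSet k)
              {t b : ℕ} (t-cut : IsCut t) (t≤h : t ≤ h) (arrows : SuffixArrows t (suc k) b U) where

    open DecMembership (_≟_ {N}) using (_∈?_)

    Admissible : ℕ → Set
    Admissible s = t ≤ s × IsCut s × s ≤ h

    EarliestCopyIn : ℕ → List (Fin N) → Set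
    EarliestCopyIn s S = ∀ p → HasSegmentCopy t s b p →
      ∃ λ g → SegmentCopy t s b p g × (∀ i → t ≤ toℕ i → toℕ i < s → g i ∈ S)

    ArrowsPastIn : ℕ → List (Fin N) → Set
    ArrowsPastIn s S = Admissible s → ∀ p → p < N → ¬ LaterCutFits t s b p → SuffixArrows s k (suc p) (_∈ S)

    earliest-copy : ∀ s → Σ (List (Fin N)) λ S → length S ≤ h × EarliestCopyIn s S
    earliest-copy s with least? (HasSegmentCopy t s b) (HasSegmentCopy? t s b) N
    ... | inj₁ none = [] , z≤n , λ p has → ⊥-elim (none N ≤-refl (HasSegmentCopy-unbounded has))
    ... | inj₂ (q , (g , g-copy) , q-least) =
          tabulate g , ≤-reflexive (length-tabulate g) ,
          λ p has → g , SegmentCopy-widen (≮⇒≥ λ p<q → q-least p p<q has) g-copy ,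
                    λ i _ _ → ∈-tabulate⁺ i

    arrows-past : ∀ s → Σ (List (Fin N)) λ S → length S ≤ bound h k × ArrowsPastIn s S
    arrows-past s with (t ≤? s) ×-dec IsCut? s ×-dec (s ≤? h)
    ... | no inadmissible = [] , z≤n , λ admissible → ⊥-elim (inadmissible admissible)
    ... | yes (t≤s , s-cut , s≤h) with greatest? (¬_ ∘ LaterCutFits t s b) (¬? ∘ LaterCutFits? t s b) N
    ...   | inj₁ none = [] , z≤n , λ _ p p<N no-later → ⊥-elim (none p (<⇒≤ p<N) no-later)
    ...   | inj₂ (π , _ , no-later-π , π-max)
            with induction s-cut s≤h (arrows-past-pivot t-cut t≤s s≤h no-later-π arrows)
    ...     | S , |S|≤ , S-arrows =
              S , |S|≤ , λ _ p p<N no-later →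
                SuffixArrows-weaken (s≤s (≮⇒≥ λ π<p → π-max p π<p (<⇒≤ p<N) no-later)) id S-arrows

    block : ℕ → List (Fin N)
    block s = proj₁ (earliest-copy s) ++ proj₁ (arrows-past s)

    L : List (Fin N)
    L = concatMap block (upTo (suc h))

    |L|≤bound : length L ≤ bound h (suc k)
    |L|≤bound = subst (λ m → length L ≤ m * (h + bound h k)) (length-upTo (suc h))
      (length-concatMap≤ block block-size (upTo (suc h)))
      where
      block-size : ∀ s → length (block s) ≤ h + bound h k
      block-size s = ≤-trans (≤-reflexive (length-++ (proj₁ (earliest-copy s))))
                       (+-mono-≤ (proj₁ (proj₂ (earliest-copy s))) (proj₁ (proj₂ (arrows-past s))))

    block⊆L : ∀ {s} → s ≤ h → ∀ {x} → x ∈ block s → x ∈ L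
    block⊆L s≤h x∈block = ∈-concatMap⁺ block (lose (∈-upTo⁺ (s≤s s≤h)) x∈block)

    L-earliest : ∀ {s} → s ≤ h → EarliestCopyIn s L
    L-earliest {s} s≤h p has with proj₂ (proj₂ (earliest-copy s)) p has
    ... | g , g-copy , g∈S = g , g-copy , λ i t≤i i<s → block⊆L s≤h (∈-++⁺ˡ (g∈S i t≤i i<s))

    L-arrows-past : ∀ {s} → s ≤ h → ArrowsPastIn s L
    L-arrows-past {s} s≤h admissible p p<N no-later =
      SuffixArrows-weaken ≤-refl (block⊆L s≤h ∘ ∈-++⁺ʳ (proj₁ (earliest-copy s)))
        (proj₂ (proj₂ (arrows-past s)) admissible p p<N no-later)

    BlueEdgeInto : Colouring F → Fin N → Set
    BlueEdgeInto c y = ∃ λ x → x ∈ L × y ∈ L × b ≤ toℕ x × toℕ x < toℕ y × adj F x y ≡ true × c x y ≡ false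

    BlueEdgeInto? : ∀ c → Decidable (BlueEdgeInto c)
    BlueEdgeInto? c y = any? λ x → (x ∈? L) ×-dec (y ∈? L) ×-dec (b ≤? toℕ x) ×-dec (toℕ x <? toℕ y) ×-dec
                                   (adj F x y ≟ᵇ true) ×-dec (c x y ≟ᵇ false)

    -- The earliest copy of H[t,s) lies in L below every blue edge of L, so all its edges are red.
    extend-below-blue : ∀ {c s p} → IsCut s → s ≤ h → (∀ z → BlueEdgeInto c z → p ≤ toℕ z) →
      HasSegmentCopy t s b p → RedSuffixCopy c s (λ x → (x ∈ L × b ≤ toℕ x) × p < toℕ x) →
      RedSuffixCopy c t (λ x → x ∈ L × b ≤ toℕ x)
    extend-below-blue {c} {s} {p} s-cut s≤h blue-above has suffix
      with L-earliest s≤h p has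
    ... | g , g-copy@(g-mono , g-edges , g-window) , g∈L =
          glue s-cut g-copy g-red (λ i t≤i i<s → g∈L i t≤i i<s , proj₁ (g-window i t≤i i<s)) suffix
      where
      g-red : ∀ i j → t ≤ toℕ i → toℕ i < toℕ j → toℕ j < s → adj H i j ≡ true → c (g i) (g j) ≡ true
      g-red i j t≤i i<j j<s e with c (g i) (g j) in colour
      ... | true = refl
      ... | false = ⊥-elim (<⇒≱ (proj₂ (g-window j t≤j j<s)) (blue-above (g j)
              (g i , g∈L i t≤i (<-trans i<j j<s) , g∈L j t≤j j<s , proj₁ (g-window i t≤i (<-trans i<j j<s)) ,
               g-mono i j t≤i i<j j<s , g-edges i j t≤i i<j j<s e , colour)))
        where
        t≤j = ≤-trans t≤i (<⇒≤ i<j)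

    Fits : ℕ → ℕ → Set
    Fits p s = IsCut s × HasSegmentCopy t s b p

    fits-at-t : Fin N → ∀ p → Fits p t
    fits-at-t y p = t-cut , (λ _ → y) , SegmentCopy-empty (λ _ → y)

    last-fitting-cut : Fin N → ∀ p → ∃ λ s → Admissible s × HasSegmentCopy t s b p × ¬ LaterCutFits t s b p
    last-fitting-cut y p with greatest? (Fits p) (λ s → IsCut? s ×-dec HasSegmentCopy? t s b p) h
    ... | inj₁ none = ⊥-elim (none t t≤h (fits-at-t y p))
    ... | inj₂ (s , s≤h , (s-cut , s-copy) , s-max) =
          s , (≮⇒≥ (λ s<t → s-max t s<t t≤h (fits-at-t y p)) , s-cut , s≤h) , s-copy ,
          λ (r , s<r , r-cut , r-copy) → s-max (toℕ r) s<r (≤-pred (toℕ<n r)) (r-cut , r-copy)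

    full-copy : HasSegmentCopy t h b N
    full-copy with arrows (λ _ _ → true)
    ... | inj₁ copy = RedSuffixCopy.emb copy , RedSuffixCopy⇒SegmentCopy copy (λ i _ _ → toℕ<n _)
    ... | inj₂ (edge _ _ _ _ _ _ _ () _)

    arrows-past-first-blue : ∀ c y → BlueEdgeInto c y → (∀ z → BlueEdgeInto c z → toℕ y ≤ toℕ z) →
      RedSuffixCopy c t (λ x → x ∈ L × b ≤ toℕ x) ⊎ BlueChain F c (_∈ L) (suc k) b
    arrows-past-first-blue c y (x , x∈L , y∈L , b≤x , x<y , e , blue) y-first
      with last-fitting-cut y (toℕ y)
    ... | s , admissible@(_ , s-cut , s≤h) , s-copy , no-later
      with L-arrows-past s≤h admissible (toℕ y) (toℕ<n y) no-later c
    ...   | inj₂ chain = inj₂ (edge x y b≤x x<y x∈L y∈L e blue chain)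
    ...   | inj₁ suffix = inj₁ (extend-below-blue s-cut s≤h y-first s-copy
              (RedSuffixCopy-within (λ (z∈L , y<z) → (z∈L , ≤-trans b≤x (<⇒≤ (<-trans x<y y<z))) , y<z)
                suffix))

    arrows-in-L : SuffixArrows t (suc k) b (_∈ L)
    arrows-in-L c with leastFin? (BlueEdgeInto c) (BlueEdgeInto? c)
    ... | inj₁ no-blue =
          inj₁ (extend-below-blue IsCut-end ≤-refl (λ z blue → ⊥-elim (no-blue z blue)) full-copy
                  (RedSuffixCopy-empty (proj₁ full-copy)))
    ... | inj₂ (y , blue-y , y-first) = arrows-past-first-blue c y blue-y y-first

  small-arrowing-set : ∀ k → HasSmallArrowingSet k
  small-arrowing-set zero _ _ _ = [] , z≤n , λ _ → inj₂ []
  small-arrowing-set (suc k) t-cut t≤h arrows =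
    L , |L|≤bound , arrows-in-L
    where open Step k (small-arrowing-set k) t-cut t≤h arrows

module _ {F H H′ : OGraph} {k : ℕ} (H-noIsolated : NoIsolated H) (H′≅M : Iso H′ (monotoneMatching k)) where
  open Core F H H-noIsolated

  arrows⇒suffixArrows : Arrows F H H′ → SuffixArrows 0 (suc k) 0 U
  arrows⇒suffixArrows F-arrows c with F-arrows c
  ... | inj₁ (f , f-mono , f-edges) = inj₁ record
    { emb = f ; mono = λ i j _ → f-mono i j ; red = λ i j _ → f-edges i j ; within = λ _ _ → tt , z≤n }
  ... | inj₂ blue =
        inj₂ (matching⇒blueChain k (CopyWithin-transport (Iso-sym H′≅M) (copyWithin blue λ _ → tt)))

  suffixArrows⇒arrowsWithin : ∀ {L} → SuffixArrows 0 (suc k) 0 (_∈ L) →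
    ∀ c → CopyWithin F c true H (_∈ L) ⊎ CopyWithin F c false H′ (_∈ L)
  suffixArrows⇒arrowsWithin arrows c with arrows c
  ... | inj₁ copy =
        inj₁ (copyWithin (emb , (λ i j → mono i j z≤n) , (λ i j → red i j z≤n)) λ i → proj₁ (within i z≤n))
    where open RedSuffixCopy copy
  ... | inj₂ chain = inj₂ (CopyWithin-transport H′≅M (blueChain⇒matching k chain))

  minimal⇒size≤bound : MinimalArrows F H H′ → n F ≤ bound (n H) (suc k)
  minimal⇒size≤bound F-minimal@(F-arrows , _)
    with small-arrowing-set (suc k) IsCut-zero z≤n (arrows⇒suffixArrows F-arrows)
  ... | L , |L|≤bound , L-arrows =
        ≤-trans (minimal⇒size≤ F-minimal L (suffixArrows⇒arrowsWithin L-arrows)) |L|≤bound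

corollary10 : (H H' : OGraph) → IsMonotoneMatching H' → NoIsolated H → RamseyFinite H H'
corollary10 H H′ (k , H′≅M) H-noIsolated =
  graphsUpTo (bound (n H) (suc k)) ,
  λ F F-minimal →
    graphsUpTo-complete _ F (minimal⇒size≤bound {F} {H} {H′} {k} H-noIsolated H′≅M F-minimal)
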